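{- Let $L,a,a_1,\ldots,a_{L-1}$ be positive integers with $a\ge 3$, and let $x$ be the real number with purely periodic-tail continued fraction $$x=[a;\overline{a_1,\ldots,a_{L-1},a,a_{L-1},\ldots,a_1,2a}]$$ (period of length $2L$; for $L=1$ the period is $(a,2a)$). Put $R=q_{L-1}(a_1,\ldots,a_{L-1})$, $S=q_{L-2}(a_1,\ldots,a_{L-2})$, $T=q_{L-2}(a_2,\ldots,a_{L-1})$. Then $$x^2=a^2+2a\frac{T}{R}+\frac{T^2+2\cdot(-1)^{L-1}}{R^2}+\frac{2\cdot(-1)^{L-1}(T-2S)}{R^2(aR+2S)}.$$
   Context: The polynomials $q_n\in\mathbb{Z}[x_1,\ldots,x_n]$ are defined by $q_{ -1}=0$, $q_0=1$ and $q_n(x_1,\ldots,x_n)=x_nq_{n-1}(x_1,\ldots,x_{n-1})+q_{n-2}(x_1,\ldots,x_{n-2})$ for $n\ge1$; by convention $q_{ -1}=0$ and $q_0=1$ whatever the (empty or formally negative-length) argument list is. They satisfy $[x_0;x_1,\ldots,x_n]=q_{n+1}(x_0,\ldots,x_n)/q_n(x_1,\ldots,x_n)$. -}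

module Defs where

open import Data.Nat as ℕ using (ℕ; zero; suc; _%_)
open import Data.List using (List; []; _∷_; _++_; reverse; map; upTo; length)
open import Data.Integer as ℤ using (ℤ; +_)
open import Data.Rational as ℚ using (ℚ; 0ℚ)

-- Continuant q_n(x_1,...,x_n) given the REVERSED argument list (x_n, x_{n-1}, ..., x_1):
-- q_0 = 1, q_1(x_1) = x_1 * q_0 + q_{-1} = x_1, q_n = x_n q_{n-1} + q_{n-2}.
qRev : List ℕ → ℕ
qRev [] = 1
qRev (x ∷ []) = x
qRev (x ∷ y ∷ r) = x ℕ.* qRev (y ∷ r) ℕ.+ qRev r

q : List ℕ → ℕ
q xs = qRev (reverse xs)

-- q_{n-1}(x_1,...,x_{n-1}) for the list (x_1,...,x_n); equals q_{-1} = 0 when n = 0.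
qDropLast : List ℕ → ℕ
qDropLast xs with reverse xs
... | [] = 0
... | _ ∷ r = qRev r

qDropFirst : List ℕ → ℕ
qDropFirst [] = 0
qDropFirst (_ ∷ r) = q r

nth : List ℕ → ℕ → ℕ
nth [] _ = 0
nth (x ∷ _) zero = x
nth (_ ∷ r) (suc k) = nth r k

-- Division of an integer by a natural number as a rational; by convention 0 if the
-- denominator is 0 (never used here: all denominators are positive).
sdiv : ℤ → ℕ → ℚ
sdiv n zero = 0ℚ
sdiv n (suc d) = n ℚ./ suc d

-- The period (a_1,...,a_{L-1}, a, a_{L-1},...,a_1, 2a) of length 2L, where as = (a_1,...,a_{L-1}).
period : ℕ → List ℕ → List ℕ
period a as = as ++ (a ∷ reverse as ++ (2 ℕ.* a ∷ []))

-- Partial quotients b_0, b_1, ... of x = [a; period, period, ...].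
pq : ℕ → List ℕ → ℕ → ℕ
pq a as zero = a
pq a as (suc k) = nth (period a as) (k % (2 ℕ.* suc (length as)))

-- n-th convergent [b_0; b_1, ..., b_n] = q_{n+1}(b_0..b_n) / q_n(b_1..b_n).
convergent : ℕ → List ℕ → ℕ → ℚ
convergent a as n =
  sdiv (+ q (map (pq a as) (upTo (suc n)))) (q (map (λ i → pq a as (suc i)) (upTo n)))

-- The right-hand side, with L = length as + 1, R, S, T as in the paper.
rhs : ℕ → List ℕ → ℚ
rhs a as =
  (+ (a ℕ.* a)) ℚ./ 1
  ℚ.+ sdiv (+ (2 ℕ.* a ℕ.* T)) R
  ℚ.+ sdiv (+ (T ℕ.* T) ℤ.+ (+ 2) ℤ.* σ) (R ℕ.* R)
  ℚ.+ sdiv ((+ 2) ℤ.* σ ℤ.* (+ T ℤ.- + (2 ℕ.* S))) (R ℕ.* R ℕ.* (a ℕ.* R ℕ.+ 2 ℕ.* S))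
  where
    R = q as
    S = qDropLast as
    T = qDropFirst as
    σ = (ℤ.- (+ 1)) ℤ.^ length as

-- x² = r, where x is the real number given as the limit of the convergents
-- (Cauchy-sequence reading): the squares of the convergents converge to r in ℚ.
SquareOfCFIs : (ℕ → ℚ) → ℚ → Set
SquareOfCFIs c r = ∀ (ε : ℚ) → 0ℚ ℚ.< ε →
  Σ' ℕ (λ N → ∀ n → N ℕ.≤ n → ℚ.∣ c n ℚ.* c n ℚ.- r ∣ ℚ.< ε)
  where open import Data.Product renaming (Σ to Σ')

-- Write F(X, Y) = D X² − K Y², where K / D is the claimed value of x², and p_n / q_n for the
-- convergents. The Gram matrix of F on consecutive vectors (p_n, q_n), (p_{n−1}, q_{n−1})
-- changes by a fixed integral step for each partial quotient. The period is a palindrome around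
-- its middle quotient a, and K / D is exactly the value for which that middle step acts as the
-- reflection (w′, w) ↦ (w, −w′); together with the final quotient 2a this makes one period
-- return the Gram matrix to its initial value. So F(p_n, q_n) takes only finitely many values,
-- and p_n² / q_n² − K / D = F(p_n, q_n) / (D q_n²) tends to 0 because q_n ≥ n / 2.

module Submission where

open import Defs
open import Data.Nat using (ℕ; _≤_)
open import Data.List using (List)
open import Data.List.Relation.Unary.All using (All)

open import Data.Integer as ℤ using (ℤ; +_; +[1+_]; -[1+_]; 0ℤ; _+_; _*_; _-_; -_; ∣_∣; NonZero)
import Data.Integer.Properties as ℤₚ
open import Data.Integer.Tactic.RingSolver using (solve-∀)
open import Data.List using ([]; _∷_; _++_; _∷ʳ_; reverse; foldl; foldr; length; take; applyUpTo; map; upTo)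
import Data.List.Properties as Listₚ
open import Data.List.Relation.Unary.All as All using ([]; _∷_)
import Data.List.Relation.Unary.All.Properties as Allₚ
import Data.List.Relation.Unary.Any.Properties as Anyₚ
open import Data.Nat as ℕ using (zero; suc; z≤n; s≤s; _<_)
open import Data.Nat.Coprimality using (Coprime)
open import Data.Nat.DivMod using (_%_; m%n<n; m<n⇒m%n≡m; n%n≡0; m≡m%n+[m/n]*n; [m+kn]%n≡m%n)
import Data.Nat.Properties as ℕₚ
import Data.Nat.Tactic.RingSolver as NatSolver
open import Data.Product using (_×_; _,_; proj₁; proj₂; ∃-syntax)
open import Data.Rational as ℚ using (ℚ; mkℚ; toℚᵘ)
import Data.Rational.Properties as ℚₚ
open import Data.Rational.Unnormalised as ℚᵘ using (ℚᵘ; mkℚᵘ; ↥_; ↧_; ↧ₙ_)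
import Data.Rational.Unnormalised.Properties as ℚᵘₚ
open import Data.Sum using (inj₁; inj₂)
open import Function using (_$_; _∘_; flip)
open import Relation.Binary.PropositionalEquality

open import Algebra.Properties.CommutativeSemigroup ℤₚ.*-commutativeSemigroup
  using (interchange; xy∙z≈xz∙y; x∙yz≈yx∙z)
open import Algebra.Properties.CommutativeSemigroup ℕₚ.*-commutativeSemigroup
  using () renaming (xy∙z≈xz∙y to xy*z≡xz*y)

-- Rationals as fractions of integers

infix 4 _≋ᵘ_/_ _≋_/_

data _≋ᵘ_/_ (x : ℚᵘ) (n d : ℤ) : Set where
  cross : ↥ x * d ≡ n * ↧ x → x ≋ᵘ n / d

_≋_/_ : ℚ → ℤ → ℤ → Set
p ≋ n / d = toℚᵘ p ≋ᵘ n / d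

module _ {a b n₁ d₁ c e n₂ d₂ : ℤ} (ad≡nb : a * d₁ ≡ n₁ * b) (cd≡ne : c * d₂ ≡ n₂ * e) where

  cross-+ : (a * e + c * b) * (d₁ * d₂) ≡ (n₁ * d₂ + n₂ * d₁) * (b * e)
  cross-+ = begin
    (a * e + c * b) * (d₁ * d₂)             ≡⟨ regroup a b c e d₁ d₂ ⟩
    (a * d₁) * (e * d₂) + (c * d₂) * (b * d₁) ≡⟨ cong₂ (λ u v → u * (e * d₂) + v * (b * d₁)) ad≡nb cd≡ne ⟩
    (n₁ * b) * (e * d₂) + (n₂ * e) * (b * d₁) ≡⟨ collect n₁ b n₂ e d₁ d₂ ⟩
    (n₁ * d₂ + n₂ * d₁) * (b * e)             ∎
    where
    open ≡-Reasoning
    regroup : ∀ a b c e d₁ d₂ → (a * e + c * b) * (d₁ * d₂) ≡ (a * d₁) * (e * d₂) + (c * d₂) * (b * d₁)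
    regroup = solve-∀
    collect : ∀ n₁ b n₂ e d₁ d₂ → (n₁ * b) * (e * d₂) + (n₂ * e) * (b * d₁) ≡ (n₁ * d₂ + n₂ * d₁) * (b * e)
    collect = solve-∀

  cross-* : (a * c) * (d₁ * d₂) ≡ (n₁ * n₂) * (b * e)
  cross-* = begin
    (a * c) * (d₁ * d₂)     ≡⟨ interchange a c d₁ d₂ ⟩
    (a * d₁) * (c * d₂)     ≡⟨ cong₂ _*_ ad≡nb cd≡ne ⟩
    (n₁ * b) * (n₂ * e)     ≡⟨ interchange n₁ b n₂ e ⟩
    (n₁ * n₂) * (b * e)     ∎
    where open ≡-Reasoning

≋ᵘ-+ : ∀ {x y n₁ d₁ n₂ d₂} → x ≋ᵘ n₁ / d₁ → y ≋ᵘ n₂ / d₂ → x ℚᵘ.+ y ≋ᵘ n₁ * d₂ + n₂ * d₁ / d₁ * d₂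
≋ᵘ-+ {x@(mkℚᵘ _ _)} {y@(mkℚᵘ _ _)} {n₁} {d₁} {n₂} {d₂} (cross hx) (cross hy) = cross $
  trans (cross-+ {↥ x} {↧ x} {n₁} {d₁} {↥ y} {↧ y} {n₂} {d₂} hx hy)
        (cong ((n₁ * d₂ + n₂ * d₁) *_) (sym (ℤₚ.pos-* (↧ₙ x) (↧ₙ y))))

≋ᵘ-* : ∀ {x y n₁ d₁ n₂ d₂} → x ≋ᵘ n₁ / d₁ → y ≋ᵘ n₂ / d₂ → x ℚᵘ.* y ≋ᵘ n₁ * n₂ / d₁ * d₂
≋ᵘ-* {x@(mkℚᵘ _ _)} {y@(mkℚᵘ _ _)} {n₁} {d₁} {n₂} {d₂} (cross hx) (cross hy) = cross $
  trans (cross-* {↥ x} {↧ x} {n₁} {d₁} {↥ y} {↧ y} {n₂} {d₂} hx hy)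
        (cong ((n₁ * n₂) *_) (sym (ℤₚ.pos-* (↧ₙ x) (↧ₙ y))))

≋ᵘ-neg : ∀ {x n d} → x ≋ᵘ n / d → ℚᵘ.- x ≋ᵘ - n / d
≋ᵘ-neg {mkℚᵘ a b} {n} {d} (cross h) = cross $ begin
  - a * d      ≡⟨ ℤₚ.neg-distribˡ-* a d ⟨
  - (a * d)    ≡⟨ cong -_ h ⟩
  - (n * + suc b) ≡⟨ ℤₚ.neg-distribˡ-* n (+ suc b) ⟩
  - n * + suc b ∎
  where open ≡-Reasoning

≋ᵘ-resp-≃ : ∀ {x y n d} → x ℚᵘ.≃ y → y ≋ᵘ n / d → x ≋ᵘ n / d
≋ᵘ-resp-≃ {x} {y} {n} {d} (ℚᵘ.*≡* x≃y) (cross h) = cross $ ℤₚ.*-cancelʳ-≡ _ _ (↧ y) (begin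
  ↥ x * d * ↧ y    ≡⟨ xy∙z≈xz∙y (↥ x) d (↧ y) ⟩
  ↥ x * ↧ y * d    ≡⟨ cong (_* d) x≃y ⟩
  ↥ y * ↧ x * d    ≡⟨ xy∙z≈xz∙y (↥ y) (↧ x) d ⟩
  ↥ y * d * ↧ x    ≡⟨ cong (_* ↧ x) h ⟩
  n * ↧ y * ↧ x    ≡⟨ xy∙z≈xz∙y n (↧ y) (↧ x) ⟩
  n * ↧ x * ↧ y    ∎)
  where open ≡-Reasoning

≋ᵘ-cancel : ∀ {x n d n′ d′} .{{_ : NonZero d}} → n * d′ ≡ n′ * d → x ≋ᵘ n / d → x ≋ᵘ n′ / d′
≋ᵘ-cancel {x} {n} {d} {n′} {d′} nd′≡n′d (cross h) = cross $ ℤₚ.*-cancelʳ-≡ _ _ d (begin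
  ↥ x * d′ * d     ≡⟨ xy∙z≈xz∙y (↥ x) d′ d ⟩
  ↥ x * d * d′     ≡⟨ cong (_* d′) h ⟩
  n * ↧ x * d′     ≡⟨ xy∙z≈xz∙y n (↧ x) d′ ⟩
  n * d′ * ↧ x     ≡⟨ cong (_* ↧ x) nd′≡n′d ⟩
  n′ * d * ↧ x     ≡⟨ xy∙z≈xz∙y n′ d (↧ x) ⟩
  n′ * ↧ x * d     ∎)
  where open ≡-Reasoning

∣≋ᵘ∣< : ∀ {x n d} k f → x ≋ᵘ n / + d → ∣ n ∣ ℕ.* suc f < suc k ℕ.* d →
        ℚᵘ.∣ x ∣ ℚᵘ.< mkℚᵘ +[1+ k ] f
∣≋ᵘ∣< {mkℚᵘ a b} {n} {d} k f (cross h) lt =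
  ℚᵘ.*<* (subst₂ ℤ._<_ (ℤₚ.pos-* ∣ a ∣ (suc f)) (ℤₚ.pos-* (suc k) (suc b))
           (ℤ.+<+ (ℕₚ.*-cancelʳ-< d _ _ (begin-strict
    ∣ a ∣ ℕ.* suc f ℕ.* d        ≡⟨ xy*z≡xz*y ∣ a ∣ (suc f) d ⟩
    ∣ a ∣ ℕ.* d ℕ.* suc f        ≡⟨ cong (ℕ._* suc f) ∣a∣d≡∣n∣b ⟩
    ∣ n ∣ ℕ.* suc b ℕ.* suc f    ≡⟨ xy*z≡xz*y ∣ n ∣ (suc b) (suc f) ⟩
    ∣ n ∣ ℕ.* suc f ℕ.* suc b    <⟨ ℕₚ.*-monoˡ-< (suc b) lt ⟩
    suc k ℕ.* d ℕ.* suc b        ≡⟨ xy*z≡xz*y (suc k) d (suc b) ⟩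
    suc k ℕ.* suc b ℕ.* d        ∎))))
  where
  open ℕₚ.≤-Reasoning
  ∣a∣d≡∣n∣b : ∣ a ∣ ℕ.* d ≡ ∣ n ∣ ℕ.* suc b
  ∣a∣d≡∣n∣b = trans (sym (ℤₚ.abs-* a (+ d))) (trans (cong ∣_∣ h) (ℤₚ.abs-* n (+ suc b)))

≋-+ : ∀ {p q n₁ d₁ n₂ d₂} → p ≋ n₁ / d₁ → q ≋ n₂ / d₂ → p ℚ.+ q ≋ n₁ * d₂ + n₂ * d₁ / d₁ * d₂
≋-+ {p} {q} hp hq = ≋ᵘ-resp-≃ (ℚₚ.toℚᵘ-homo-+ p q) (≋ᵘ-+ hp hq)

≋-* : ∀ {p q n₁ d₁ n₂ d₂} → p ≋ n₁ / d₁ → q ≋ n₂ / d₂ → p ℚ.* q ≋ n₁ * n₂ / d₁ * d₂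
≋-* {p} {q} hp hq = ≋ᵘ-resp-≃ (ℚₚ.toℚᵘ-homo-* p q) (≋ᵘ-* hp hq)

≋-- : ∀ {p q n₁ d₁ n₂ d₂} → p ≋ n₁ / d₁ → q ≋ n₂ / d₂ → p ℚ.- q ≋ n₁ * d₂ + - n₂ * d₁ / d₁ * d₂
≋-- {p} {q} hp hq = ≋-+ {p} {ℚ.- q} hp (≋ᵘ-resp-≃ (ℚₚ.toℚᵘ-homo‿- q) (≋ᵘ-neg hq))

sdiv-≋ : ∀ n d {n′ d′} → n ≡ n′ → + d ≡ d′ → 1 ≤ d → sdiv n d ≋ n′ / d′
sdiv-≋ n (suc d) refl refl _ = ≋ᵘ-resp-≃ (ℚₚ.toℚᵘ-fromℚᵘ (mkℚᵘ n d)) (cross refl)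

∣≋∣< : ∀ {p n d} k f .{c : Coprime (suc k) (suc f)} → p ≋ n / + d → ∣ n ∣ ℕ.* suc f < suc k ℕ.* d →
       ℚ.∣ p ∣ ℚ.< mkℚ +[1+ k ] f c
∣≋∣< {p} k f h lt =
  ℚₚ.toℚᵘ-cancel-< (ℚᵘₚ.<-respˡ-≃ (ℚᵘₚ.≃-sym (ℚₚ.toℚᵘ-homo-∣-∣ p)) (∣≋ᵘ∣< k f h lt))

-- Gram matrices along the continuant recurrence

-- (f, g, h) is the Gram matrix of a pair of vectors (w′, w) for a symmetric bilinear form;
-- gramStep x passes to the pair (x w′ + w, w′) and gramSwap to (w, −w′).
Gram : Set
Gram = ℤ × ℤ × ℤ

gramStepℤ : Gram → ℤ → Gram
gramStepℤ (f , g , h) X = (X * X * f + + 2 * X * g + h , X * f + g , f)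

gramStep : Gram → ℕ → Gram
gramStep G x = gramStepℤ G (+ x)

gramSwap : Gram → Gram
gramSwap (f , g , h) = (h , - g , f)

gramStep-gramSwap-gramStep : ∀ G x → gramStep (gramSwap (gramStep G x)) x ≡ gramSwap G
gramStep-gramSwap-gramStep (f , g , h) x =
  cong₂ _,_ (entry₁ (+ x) f g h) (cong₂ _,_ (entry₂ (+ x) f g) refl)
  where
  entry₁ : ∀ X f g h → X * X * f + + 2 * X * - (X * f + g) + (X * X * f + + 2 * X * g + h) ≡ h
  entry₁ = solve-∀
  entry₂ : ∀ X f g → X * f + - (X * f + g) ≡ - g
  entry₂ = solve-∀

foldl-gramStep-reverse : ∀ G xs → foldl gramStep (gramSwap (foldl gramStep G xs)) (reverse xs) ≡ gramSwap G
foldl-gramStep-reverse G [] = refl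
foldl-gramStep-reverse G (x ∷ xs) = begin
  foldl gramStep (gramSwap (foldl gramStep (gramStep G x) xs)) (reverse (x ∷ xs))
    ≡⟨ cong (foldl gramStep _) (Listₚ.unfold-reverse x xs) ⟩
  foldl gramStep (gramSwap (foldl gramStep (gramStep G x) xs)) (reverse xs ∷ʳ x)
    ≡⟨ Listₚ.foldl-∷ʳ gramStep _ x (reverse xs) ⟩
  gramStep (foldl gramStep (gramSwap (foldl gramStep (gramStep G x) xs)) (reverse xs)) x
    ≡⟨ cong (flip gramStep x) (foldl-gramStep-reverse (gramStep G x) xs) ⟩
  gramStep (gramSwap (gramStep G x)) x
    ≡⟨ gramStep-gramSwap-gramStep G x ⟩
  gramSwap G ∎
  where open ≡-Reasoning

gramStep≡gramSwap : ∀ {f g h} a → + a * f + + 2 * g ≡ 0ℤ → gramStep (f , g , h) a ≡ gramSwap (f , g , h)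
gramStep≡gramSwap {f} {g} {h} a af+2g≡0 = cong₂ _,_
  (begin
    + a * + a * f + + 2 * + a * g + h ≡⟨ entry₁ (+ a) f g h ⟩
    + a * (+ a * f + + 2 * g) + h     ≡⟨ cong (λ e → + a * e + h) af+2g≡0 ⟩
    + a * 0ℤ + h                      ≡⟨ cong (_+ h) (ℤₚ.*-zeroʳ (+ a)) ⟩
    0ℤ + h                            ≡⟨ ℤₚ.+-identityˡ h ⟩
    h                                 ∎)
  (cong₂ _,_ (begin
    + a * f + g                       ≡⟨ entry₂ (+ a) f g ⟩
    (+ a * f + + 2 * g) - g           ≡⟨ cong (_- g) af+2g≡0 ⟩
    0ℤ - g                            ≡⟨ ℤₚ.+-identityˡ (- g) ⟩
    - g                               ∎) refl)
  where
  open ≡-Reasoning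
  entry₁ : ∀ X f g h → X * X * f + + 2 * X * g + h ≡ X * (X * f + + 2 * g) + h
  entry₁ = solve-∀
  entry₂ : ∀ X f g → X * f + g ≡ (X * f + + 2 * g) - g
  entry₂ = solve-∀

gramStep-double-gramSwap : ∀ f h a →
  gramStep (gramSwap (gramStep (f , 0ℤ , h) a)) (2 ℕ.* a) ≡ gramStep (f , 0ℤ , h) a
gramStep-double-gramSwap f h a =
  trans (cong (gramStepℤ _) (ℤₚ.pos-* 2 a)) (cong₂ _,_ (entry₁ (+ a) f h) (cong₂ _,_ (entry₂ (+ a) f) refl))
  where
  entry₁ : ∀ X f h → + 2 * X * (+ 2 * X) * f + + 2 * (+ 2 * X) * - (X * f + 0ℤ) + (X * X * f + + 2 * X * 0ℤ + h)
                    ≡ X * X * f + + 2 * X * 0ℤ + h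
  entry₁ = solve-∀
  entry₂ : ∀ X f → + 2 * X * f + - (X * f + 0ℤ) ≡ X * f + 0ℤ
  entry₂ = solve-∀

foldl-gramStep-period : ∀ a as f h →
  let G = gramStep (f , 0ℤ , h) a
      M = foldl gramStep G as
  in gramStep M a ≡ gramSwap M → foldl gramStep G (period a as) ≡ G
foldl-gramStep-period a as f h middle = begin
  foldl gramStep G (as ++ a ∷ reverse as ∷ʳ 2 ℕ.* a)    ≡⟨ Listₚ.foldl-++ gramStep G as _ ⟩
  foldl gramStep (gramStep M a) (reverse as ∷ʳ 2 ℕ.* a) ≡⟨ Listₚ.foldl-∷ʳ gramStep _ (2 ℕ.* a) (reverse as) ⟩
  gramStep (foldl gramStep (gramStep M a) (reverse as)) (2 ℕ.* a)
    ≡⟨ cong (λ N → gramStep (foldl gramStep N (reverse as)) (2 ℕ.* a)) middle ⟩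
  gramStep (foldl gramStep (gramSwap M) (reverse as)) (2 ℕ.* a)
    ≡⟨ cong (flip gramStep (2 ℕ.* a)) (foldl-gramStep-reverse G as) ⟩
  gramStep (gramSwap G) (2 ℕ.* a)                        ≡⟨ gramStep-double-gramSwap f h a ⟩
  G                                                      ∎
  where
  open ≡-Reasoning
  G = gramStep (f , 0ℤ , h) a
  M = foldl gramStep G as

-- A Pair holds one coordinate of the vectors (w′, w), and formGram D K (p , p′) (q , q′) is the
-- Gram matrix of w′ = (p, q), w = (p′, q′) for the form D X² − K Y².
Pair : Set
Pair = ℤ × ℤ

pairStep : Pair → ℕ → Pair
pairStep (p , p′) x = (+ x * p + p′ , p)

formGram : ℤ → ℤ → Pair → Pair → Gram
formGram D K (p , p′) (q , q′) =
  (D * p * p - K * q * q , D * p * p′ - K * q * q′ , D * p′ * p′ - K * q′ * q′)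

gramStep-formGram : ∀ D K u v x → gramStep (formGram D K u v) x ≡ formGram D K (pairStep u x) (pairStep v x)
gramStep-formGram D K (p , p′) (q , q′) x =
  cong₂ _,_ (entry₁ D K (+ x) p p′ q q′) (cong₂ _,_ (entry₂ D K (+ x) p p′ q q′) refl)
  where
  entry₁ : ∀ D K X p p′ q q′ →
    X * X * (D * p * p - K * q * q) + + 2 * X * (D * p * p′ - K * q * q′) + (D * p′ * p′ - K * q′ * q′)
    ≡ D * (X * p + p′) * (X * p + p′) - K * (X * q + q′) * (X * q + q′)
  entry₁ = solve-∀
  entry₂ : ∀ D K X p p′ q q′ →
    X * (D * p * p - K * q * q) + (D * p * p′ - K * q * q′) ≡ D * (X * p + p′) * p - K * (X * q + q′) * q
  entry₂ = solve-∀

foldl-gramStep-formGram : ∀ D K u v xs →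
  foldl gramStep (formGram D K u v) xs ≡ formGram D K (foldl pairStep u xs) (foldl pairStep v xs)
foldl-gramStep-formGram D K u v [] = refl
foldl-gramStep-formGram D K u v (x ∷ xs) =
  trans (cong (λ G → foldl gramStep G xs) (gramStep-formGram D K u v x))
        (foldl-gramStep-formGram D K (pairStep u x) (pairStep v x) xs)

lincomb : ℤ → ℤ → Pair → Pair → Pair
lincomb c c′ (u₁ , u₂) (v₁ , v₂) = (c * u₁ + c′ * v₁ , c * u₂ + c′ * v₂)

foldl-pairStep-lincomb : ∀ c c′ xs →
  foldl pairStep (c , c′) xs ≡ lincomb c c′ (foldl pairStep (+ 1 , + 0) xs) (foldl pairStep (+ 0 , + 1) xs)
foldl-pairStep-lincomb c c′ [] = cong₂ _,_ (sym (entry₁ c c′)) (sym (entry₂ c c′))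
  where
  entry₁ : ∀ c c′ → c * + 1 + c′ * + 0 ≡ c
  entry₁ = solve-∀
  entry₂ : ∀ c c′ → c * + 0 + c′ * + 1 ≡ c′
  entry₂ = solve-∀
foldl-pairStep-lincomb c c′ (x ∷ xs) = begin
  foldl pairStep (+ x * c + c′ , c) xs
    ≡⟨ foldl-pairStep-lincomb (+ x * c + c′) c xs ⟩
  lincomb (+ x * c + c′) c A B
    ≡⟨ regroup (+ x) c c′ A B ⟩
  lincomb c c′ (lincomb (+ x * + 1 + + 0) (+ 1) A B) (lincomb (+ x * + 0 + + 1) (+ 0) A B)
    ≡⟨ cong₂ (lincomb c c′) (foldl-pairStep-lincomb _ _ xs) (foldl-pairStep-lincomb _ _ xs) ⟨
  lincomb c c′ (foldl pairStep (pairStep (+ 1 , + 0) x) xs) (foldl pairStep (pairStep (+ 0 , + 1) x) xs) ∎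
  where
  open ≡-Reasoning
  A = foldl pairStep (+ 1 , + 0) xs
  B = foldl pairStep (+ 0 , + 1) xs
  component : ∀ X c c′ a b → (X * c + c′) * a + c * b
    ≡ c * ((X * + 1 + + 0) * a + + 1 * b) + c′ * ((X * + 0 + + 1) * a + + 0 * b)
  component = solve-∀
  regroup : ∀ X c c′ A B →
    lincomb (X * c + c′) c A B
    ≡ lincomb c c′ (lincomb (X * + 1 + + 0) (+ 1) A B) (lincomb (X * + 0 + + 1) (+ 0) A B)
  regroup X c c′ (a₁ , a₂) (b₁ , b₂) = cong₂ _,_ (component X c c′ a₁ b₁) (component X c c′ a₂ b₂)

det : Pair → Pair → ℤ
det (u₁ , u₂) (v₁ , v₂) = u₁ * v₂ - u₂ * v₁

det-foldl-pairStep : ∀ u v xs →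
  det (foldl pairStep u xs) (foldl pairStep v xs) ≡ (- + 1) ℤ.^ length xs * det u v
det-foldl-pairStep u v [] = sym (ℤₚ.*-identityˡ (det u v))
det-foldl-pairStep u v (x ∷ xs) = begin
  det (foldl pairStep (pairStep u x) xs) (foldl pairStep (pairStep v x) xs)
    ≡⟨ det-foldl-pairStep (pairStep u x) (pairStep v x) xs ⟩
  σ * det (pairStep u x) (pairStep v x)  ≡⟨ cong (σ *_) (det-pairStep u v) ⟩
  σ * (- + 1 * det u v)                   ≡⟨ x∙yz≈yx∙z σ (- + 1) (det u v) ⟩
  - + 1 * σ * det u v                     ∎
  where
  open ≡-Reasoning
  σ = (- + 1) ℤ.^ length xs
  flipSign : ∀ X u₁ u₂ v₁ v₂ → (X * u₁ + u₂) * v₁ - u₁ * (X * v₁ + v₂) ≡ - + 1 * (u₁ * v₂ - u₂ * v₁)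
  flipSign = solve-∀
  det-pairStep : ∀ u v → det (pairStep u x) (pairStep v x) ≡ - + 1 * det u v
  det-pairStep (u₁ , u₂) (v₁ , v₂) = flipSign (+ x) u₁ u₂ v₁ v₂

-- Continuants

foldr-pairStep-qRev : ∀ y ys → foldr (flip pairStep) (+ 1 , + 0) (y ∷ ys) ≡ (+ qRev (y ∷ ys) , + qRev ys)
foldr-pairStep-qRev y [] = cong (_, + 1) (trans (ℤₚ.+-identityʳ (+ y * + 1)) (ℤₚ.*-identityʳ (+ y)))
foldr-pairStep-qRev y (z ∷ zs) = begin
  pairStep (foldr (flip pairStep) (+ 1 , + 0) (z ∷ zs)) y
    ≡⟨ cong (flip pairStep y) (foldr-pairStep-qRev z zs) ⟩
  (+ y * + qRev (z ∷ zs) + + qRev zs , + qRev (z ∷ zs))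
    ≡⟨ cong (λ p → p + + qRev zs , _) (ℤₚ.pos-* y _) ⟨
  (+ (y ℕ.* qRev (z ∷ zs)) + + qRev zs , + qRev (z ∷ zs))
    ≡⟨ cong (_, + qRev (z ∷ zs)) (ℤₚ.pos-+ (y ℕ.* qRev (z ∷ zs)) _) ⟨
  (+ qRev (y ∷ z ∷ zs) , + qRev (z ∷ zs))                 ∎
  where open ≡-Reasoning

foldl-pairStep-continuant : ∀ xs → foldl pairStep (+ 1 , + 0) xs ≡ (+ q xs , + qDropLast xs)
foldl-pairStep-continuant xs = trans (sym (Listₚ.reverse-foldr (flip pairStep) _ xs)) (onReverse xs)
  where
  onReverse : ∀ xs → foldr (flip pairStep) (+ 1 , + 0) (reverse xs) ≡ (+ q xs , + qDropLast xs)
  onReverse xs with reverse xs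
  ... | []     = refl
  ... | y ∷ ys = foldr-pairStep-qRev y ys

proj₁-foldl-pairStep-01 : ∀ xs → proj₁ (foldl pairStep (+ 0 , + 1) xs) ≡ + qDropFirst xs
proj₁-foldl-pairStep-01 [] = refl
proj₁-foldl-pairStep-01 (x ∷ xs) = begin
  proj₁ (foldl pairStep (+ x * + 0 + + 1 , + 0) xs)
    ≡⟨ cong (λ c → proj₁ (foldl pairStep (c + + 1 , + 0) xs)) (ℤₚ.*-zeroʳ (+ x)) ⟩
  proj₁ (foldl pairStep (+ 1 , + 0) xs)             ≡⟨ cong proj₁ (foldl-pairStep-continuant xs) ⟩
  + q xs                                            ∎
  where open ≡-Reasoning

-- Folding along a periodic sequence

All-reverse : ∀ {A : Set} {P : A → Set} {xs} → All P xs → All P (reverse xs)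
All-reverse ps = All.tabulate (All.lookup ps ∘ Anyₚ.reverse⁻)

All-nth : ∀ {P : ℕ → Set} {xs j} → All P xs → j < length xs → P (nth xs j)
All-nth {j = zero}  (px ∷ _)  _         = px
All-nth {j = suc j} (_ ∷ pxs) (s≤s j<n) = All-nth pxs j<n

take-suc-nth : ∀ {j} xs → j < length xs → take (suc j) xs ≡ take j xs ∷ʳ nth xs j
take-suc-nth {zero}  (x ∷ xs) _         = refl
take-suc-nth {suc j} (x ∷ xs) (s≤s j<n) = cong (x ∷_) (take-suc-nth xs j<n)

<-bounded : ∀ (f : ℕ → ℕ) m → ∃[ C ] (∀ {j} → j < m → f j ≤ C)
<-bounded f zero    = 0 , λ ()
<-bounded f (suc m) = C ℕ.⊔ f m , bound
  where
  C = proj₁ (<-bounded f m)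
  bound : ∀ {j} → j < suc m → f j ≤ C ℕ.⊔ f m
  bound j<1+m with ℕₚ.m≤n⇒m<n∨m≡n (ℕₚ.≤-pred j<1+m)
  ... | inj₁ j<m  = ℕₚ.≤-trans (proj₂ (<-bounded f m) j<m) (ℕₚ.m≤m⊔n C (f m))
  ... | inj₂ refl = ℕₚ.m≤n⊔m C (f m)

suc-% : ∀ n m .{{_ : ℕ.NonZero m}} → suc n % m ≡ suc (n % m) % m
suc-% n m = trans (cong (λ k → suc k % m) (m≡m%n+[m/n]*n n m)) ([m+kn]%n≡m%n (suc (n % m)) (n ℕ./ m) m)

module _ {S : Set} (act : S → ℕ → S) {s : S} {l : List ℕ} {m : ℕ} .{{_ : ℕ.NonZero m}}
         (length≡m : length l ≡ m) (l-fixes-s : foldl act s l ≡ s) where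

  foldl-take-% : ∀ {j} → j ≤ m → foldl act s (take j l) ≡ foldl act s (take (j % m) l)
  foldl-take-% j≤m with ℕₚ.m≤n⇒m<n∨m≡n j≤m
  ... | inj₁ j<m  = cong (λ i → foldl act s (take i l)) (sym (m<n⇒m%n≡m j<m))
  ... | inj₂ refl = begin
    foldl act s (take m l)       ≡⟨ cong (foldl act s) (Listₚ.take-all m l (ℕₚ.≤-reflexive length≡m)) ⟩
    foldl act s l                ≡⟨ l-fixes-s ⟩
    s                            ≡⟨ cong (λ i → foldl act s (take i l)) (n%n≡0 m) ⟨
    foldl act s (take (m % m) l) ∎
    where open ≡-Reasoning

  foldl-cycle : ∀ n → foldl act s (applyUpTo (λ k → nth l (k % m)) n) ≡ foldl act s (take (n % m) l)
  foldl-cycle zero    = foldl-take-% z≤n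
  foldl-cycle (suc n) = begin
    foldl act s (applyUpTo g (suc n))                  ≡⟨ cong (foldl act s) (Listₚ.applyUpTo-∷ʳ g n) ⟨
    foldl act s (applyUpTo g n ∷ʳ g n)                 ≡⟨ Listₚ.foldl-∷ʳ act s (g n) (applyUpTo g n) ⟩
    act (foldl act s (applyUpTo g n)) (g n)            ≡⟨ cong (flip act (g n)) (foldl-cycle n) ⟩
    act (foldl act s (take (n % m) l)) (g n)           ≡⟨ Listₚ.foldl-∷ʳ act s (g n) (take (n % m) l) ⟨
    foldl act s (take (n % m) l ∷ʳ nth l (n % m))      ≡⟨ cong (foldl act s) (take-suc-nth l n%m<length) ⟨
    foldl act s (take (suc (n % m)) l)                 ≡⟨ foldl-take-% (m%n<n n m) ⟩
    foldl act s (take (suc (n % m) % m) l)             ≡⟨ cong (λ i → foldl act s (take i l)) (suc-% n m) ⟨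
    foldl act s (take (suc n % m) l)                   ∎
    where
    open ≡-Reasoning
    g = λ k → nth l (k % m)
    n%m<length : n % m < length l
    n%m<length = subst (n % m <_) (sym length≡m) (m%n<n n m)

  foldl-cycle-bounded : ∀ (μ : S → ℕ) →
    ∃[ C ] (∀ n → μ (foldl act s (applyUpTo (λ k → nth l (k % m)) n)) ≤ C)
  foldl-cycle-bounded μ = C , λ n → subst (_≤ C) (cong μ (sym (foldl-cycle n))) (bound (m%n<n n m))
    where
    C = proj₁ (<-bounded (λ j → μ (foldl act s (take j l))) m)
    bound = proj₂ (<-bounded (λ j → μ (foldl act s (take j l))) m)

-- Growth of continuants

1≤qRev : ∀ {xs} → All (1 ≤_) xs → 1 ≤ qRev xs
1≤qRev []                 = s≤s z≤n
1≤qRev (1≤x ∷ [])         = 1≤x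
1≤qRev (1≤x ∷ ps@(_ ∷ _)) = ℕₚ.≤-trans (ℕₚ.*-mono-≤ 1≤x (1≤qRev ps)) (ℕₚ.m≤m+n _ _)

length≤2*qRev : ∀ {xs} → All (1 ≤_) xs → length xs ≤ 2 ℕ.* qRev xs
length≤2*qRev []                           = z≤n
length≤2*qRev {x ∷ []} (1≤x ∷ [])          = ℕₚ.≤-trans 1≤x (ℕₚ.m≤n*m x 2)
length≤2*qRev {x ∷ y ∷ r} (1≤x ∷ ps@(_ ∷ ps′)) = begin
  suc (suc (length r))     ≤⟨ s≤s (s≤s (length≤2*qRev ps′)) ⟩
  suc (suc (2 ℕ.* qRev r)) ≡⟨ ℕₚ.*-suc 2 (qRev r) ⟨
  2 ℕ.* suc (qRev r)       ≤⟨ ℕₚ.*-monoʳ-≤ 2 (ℕₚ.+-monoˡ-≤ (qRev r) (ℕₚ.*-mono-≤ 1≤x (1≤qRev ps))) ⟩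
  2 ℕ.* qRev (x ∷ y ∷ r)   ∎
  where open ℕₚ.≤-Reasoning

1≤q : ∀ {xs} → All (1 ≤_) xs → 1 ≤ q xs
1≤q ps = 1≤qRev (All-reverse ps)

length≤2*q : ∀ {xs} → All (1 ≤_) xs → length xs ≤ 2 ℕ.* q xs
length≤2*q {xs} ps = subst (_≤ 2 ℕ.* q xs) (Listₚ.length-reverse xs) (length≤2*qRev (All-reverse ps))

-- The expansion [a; a₁, …, a_{L−1}, a, a_{L−1}, …, a₁, 2a, …]

module PeriodicExpansion (a : ℕ) (as : List ℕ) (1≤a : 1 ≤ a) (as⁺ : All (1 ≤_) as) where

  m : ℕ
  m = 2 ℕ.* suc (length as)

  length-period : length (period a as) ≡ m
  length-period = begin
    length (as ++ a ∷ reverse as ∷ʳ 2 ℕ.* a)         ≡⟨ Listₚ.length-++ as ⟩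
    length as ℕ.+ suc (length (reverse as ∷ʳ 2 ℕ.* a))
      ≡⟨ cong (λ n → length as ℕ.+ suc n) (Listₚ.length-++ (reverse as)) ⟩
    length as ℕ.+ suc (length (reverse as) ℕ.+ 1)
      ≡⟨ cong (λ n → length as ℕ.+ suc (n ℕ.+ 1)) (Listₚ.length-reverse as) ⟩
    length as ℕ.+ suc (length as ℕ.+ 1)                ≡⟨ count (length as) ⟩
    m                                                  ∎
    where
    open ≡-Reasoning
    count : ∀ n → n ℕ.+ suc (n ℕ.+ 1) ≡ 2 ℕ.* suc n
    count = NatSolver.solve-∀

  period⁺ : All (1 ≤_) (period a as)
  period⁺ = Allₚ.++⁺ as⁺ (1≤a ∷ Allₚ.++⁺ (All-reverse as⁺) (ℕₚ.≤-trans 1≤a (ℕₚ.m≤n*m a 2) ∷ []))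

  R S T : ℕ
  R = q as
  S = qDropLast as
  T = qDropFirst as

  U : ℤ
  U = proj₂ (foldl pairStep (+ 0 , + 1) as)

  σ≡det : (- + 1) ℤ.^ length as ≡ + R * U - + S * + T
  σ≡det = begin
    (- + 1) ℤ.^ length as                                  ≡⟨ ℤₚ.*-identityʳ _ ⟨
    (- + 1) ℤ.^ length as * + 1                            ≡⟨ det-foldl-pairStep (+ 1 , + 0) (+ 0 , + 1) as ⟨
    det (foldl pairStep (+ 1 , + 0) as) (foldl pairStep (+ 0 , + 1) as)
      ≡⟨ cong₂ (λ u t → det u (t , U)) (foldl-pairStep-continuant as) (proj₁-foldl-pairStep-01 as) ⟩
    + R * U - + S * + T                                    ∎
    where open ≡-Reasoning

  P P′ : ℤ
  P  = + a * + R + + T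
  P′ = + a * + S + U

  -- K / D is x²: the value for which the middle step of the period acts as gramSwap (middle-step).
  D K : ℤ
  D = + R * + R * (+ a * + R + + 2 * + S)
  K = + R * P * (+ a * P + + 2 * P′)

  G₀ : Gram
  G₀ = (D , 0ℤ , - K)

  s₀ : Gram
  s₀ = gramStep G₀ a

  G₀≡formGram : G₀ ≡ formGram D K (+ 1 , + 0) (+ 0 , + 1)
  G₀≡formGram = cong₂ _,_ (sym (entry₁ D K)) (cong₂ _,_ (sym (entry₂ D K)) (sym (entry₃ D K)))
    where
    entry₁ : ∀ D K → D * + 1 * + 1 - K * + 0 * + 0 ≡ D
    entry₁ = solve-∀
    entry₂ : ∀ D K → D * + 1 * + 0 - K * + 0 * + 1 ≡ 0ℤ
    entry₂ = solve-∀
    entry₃ : ∀ D K → D * + 0 * + 0 - K * + 1 * + 1 ≡ - K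
    entry₃ = solve-∀

  foldl-gramStep-G₀ : ∀ xs →
    foldl gramStep G₀ xs ≡ formGram D K (foldl pairStep (+ 1 , + 0) xs) (foldl pairStep (+ 0 , + 1) xs)
  foldl-gramStep-G₀ xs =
    trans (cong (λ G → foldl gramStep G xs) G₀≡formGram) (foldl-gramStep-formGram D K _ _ xs)

  foldl-pairStep-a1 : foldl pairStep (+ a , + 1) as ≡ (P , P′)
  foldl-pairStep-a1 = begin
    foldl pairStep (+ a , + 1) as
      ≡⟨ foldl-pairStep-lincomb (+ a) (+ 1) as ⟩
    lincomb (+ a) (+ 1) (foldl pairStep (+ 1 , + 0) as) (foldl pairStep (+ 0 , + 1) as)
      ≡⟨ cong₂ (lincomb (+ a) (+ 1)) (foldl-pairStep-continuant as) (cong (_, U) (proj₁-foldl-pairStep-01 as)) ⟩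
    lincomb (+ a) (+ 1) (+ R , + S) (+ T , U)
      ≡⟨ cong₂ (λ t u → + a * + R + t , + a * + S + u) (ℤₚ.*-identityˡ (+ T)) (ℤₚ.*-identityˡ U) ⟩
    (P , P′) ∎
    where open ≡-Reasoning

  middle≡formGram : foldl gramStep s₀ as ≡ formGram D K (P , P′) (+ R , + S)
  middle≡formGram = begin
    foldl gramStep G₀ (a ∷ as)
      ≡⟨ foldl-gramStep-G₀ (a ∷ as) ⟩
    formGram D K (foldl pairStep (pairStep (+ 1 , + 0) a) as) (foldl pairStep (pairStep (+ 0 , + 1) a) as)
      ≡⟨ cong₂ (λ u v → formGram D K (foldl pairStep u as) (foldl pairStep v as))
               (cong (_, + 1) (trans (ℤₚ.+-identityʳ _) (ℤₚ.*-identityʳ (+ a))))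
               (cong (λ c → c + + 1 , + 0) (ℤₚ.*-zeroʳ (+ a))) ⟩
    formGram D K (foldl pairStep (+ a , + 1) as) (foldl pairStep (+ 1 , + 0) as)
      ≡⟨ cong₂ (formGram D K) foldl-pairStep-a1 (foldl-pairStep-continuant as) ⟩
    formGram D K (P , P′) (+ R , + S) ∎
    where open ≡-Reasoning

  middle-step : gramStep (foldl gramStep s₀ as) a ≡ gramSwap (foldl gramStep s₀ as)
  middle-step = subst (λ M → gramStep M a ≡ gramSwap M) (sym middle≡formGram)
                      (gramStep≡gramSwap a (balanced (+ a) (+ R) (+ S) (+ T) U))
    where
    balanced : ∀ a R S T U →
      let P = a * R + T ; P′ = a * S + U
          D = R * R * (a * R + + 2 * S) ; K = R * P * (a * P + + 2 * P′)
      in a * (D * P * P - K * R * R) + + 2 * (D * P * P′ - K * R * S) ≡ 0ℤ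
    balanced = solve-∀

  period-fixes-s₀ : foldl gramStep s₀ (period a as) ≡ s₀
  period-fixes-s₀ = foldl-gramStep-period a as D (- K) middle-step

  quotients : ℕ → List ℕ
  quotients n = map (λ i → pq a as (suc i)) (upTo n)

  quotients≡cycle : ∀ n → quotients n ≡ applyUpTo (λ k → nth (period a as) (k % m)) n
  quotients≡cycle = Listₚ.map-upTo _

  quotients⁺ : ∀ n → All (1 ≤_) (quotients n)
  quotients⁺ n = subst (All (1 ≤_)) (sym (quotients≡cycle n))
    (Allₚ.applyUpTo⁺₂ _ n (λ k → All-nth period⁺ (subst (k % m <_) (sym length-period) (m%n<n k m))))

  numerator denominator : ℕ → ℕ
  numerator n   = q (map (pq a as) (upTo (suc n)))
  denominator n = q (quotients n)

  numerator≡ : ∀ n → numerator n ≡ q (a ∷ quotients n)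
  numerator≡ n =
    cong (λ xs → q (a ∷ xs)) (trans (Listₚ.map-applyUpTo suc (pq a as) n) (sym (Listₚ.map-upTo _ n)))

  1≤denominator : ∀ n → 1 ≤ denominator n
  1≤denominator n = 1≤q (quotients⁺ n)

  n≤2*denominator : ∀ n → n ≤ 2 ℕ.* denominator n
  n≤2*denominator n =
    subst (_≤ 2 ℕ.* denominator n) (trans (Listₚ.length-map _ (upTo n)) (Listₚ.length-upTo n))
          (length≤2*q (quotients⁺ n))

  convergent-≋ : ∀ n → convergent a as n ≋ + numerator n / + denominator n
  convergent-≋ n = sdiv-≋ _ (denominator n) refl refl (1≤denominator n)

  formValue : ℕ → ℤ
  formValue n = D * + numerator n * + numerator n - K * + denominator n * + denominator n

  formValue≡ : ∀ n → formValue n ≡ proj₁ (foldl gramStep s₀ (quotients n))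
  formValue≡ n = sym (begin
    proj₁ (foldl gramStep G₀ (a ∷ quotients n))
      ≡⟨ cong proj₁ (foldl-gramStep-G₀ (a ∷ quotients n)) ⟩
    D * proj₁ (foldl pairStep (+ 1 , + 0) (a ∷ quotients n)) * proj₁ (foldl pairStep (+ 1 , + 0) (a ∷ quotients n))
      - K * proj₁ (foldl pairStep (+ 0 , + 1) (a ∷ quotients n)) * proj₁ (foldl pairStep (+ 0 , + 1) (a ∷ quotients n))
      ≡⟨ cong₂ (λ x y → D * x * x - K * y * y)
               (trans (cong proj₁ (foldl-pairStep-continuant (a ∷ quotients n))) (cong +_ (sym (numerator≡ n))))
               (proj₁-foldl-pairStep-01 (a ∷ quotients n)) ⟩
    formValue n ∎)
    where open ≡-Reasoning

  formValue-bounded : ∃[ C ] (∀ n → ∣ formValue n ∣ ≤ C)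
  formValue-bounded = C , λ n → subst (_≤ C) (cong ∣_∣ (sym (orbit n))) (bound n)
    where
    cycleBound = foldl-cycle-bounded gramStep {s₀} {period a as} length-period period-fixes-s₀ (∣_∣ ∘ proj₁)
    C = proj₁ cycleBound
    bound = proj₂ cycleBound
    orbit : ∀ n → formValue n ≡ proj₁ (foldl gramStep s₀ (applyUpTo (λ k → nth (period a as) (k % m)) n))
    orbit n = trans (formValue≡ n) (cong (proj₁ ∘ foldl gramStep s₀) (quotients≡cycle n))

  Dₙ : ℕ
  Dₙ = R ℕ.* R ℕ.* (a ℕ.* R ℕ.+ 2 ℕ.* S)

  +Dₙ≡D : + Dₙ ≡ D
  +Dₙ≡D = trans (ℤₚ.pos-* (R ℕ.* R) _) (cong₂ _*_ (ℤₚ.pos-* R R)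
            (trans (ℤₚ.pos-+ (a ℕ.* R) (2 ℕ.* S)) (cong₂ _+_ (ℤₚ.pos-* a R) (ℤₚ.pos-* 2 S))))

  1≤R : 1 ≤ R
  1≤R = 1≤q as⁺

  1≤Dₙ : 1 ≤ Dₙ
  1≤Dₙ = ℕₚ.*-mono-≤ (ℕₚ.*-mono-≤ 1≤R 1≤R) (ℕₚ.≤-trans (ℕₚ.*-mono-≤ 1≤a 1≤R) (ℕₚ.m≤m+n _ _))

  -- Once (−1)^(L−1) is replaced by R U − S T, clearing denominators is a polynomial identity.
  rhs-≋ : rhs a as ≋ K / D
  rhs-≋ = ≋ᵘ-cancel {{denominator≢0}} (denominators-cleared (+ a) (+ R) (+ S) (+ T) U)
                     (≋-+ (≋-+ (≋-+ term₀ term₁) term₂) term₃)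
    where
    σ = (- + 1) ℤ.^ length as
    term₀ : (+ (a ℕ.* a)) ℚ./ 1 ≋ + a * + a / + 1
    term₀ = sdiv-≋ _ 1 (ℤₚ.pos-* a a) refl (s≤s z≤n)
    term₁ : sdiv (+ (2 ℕ.* a ℕ.* T)) R ≋ + 2 * + a * + T / + R
    term₁ = sdiv-≋ _ R (trans (ℤₚ.pos-* (2 ℕ.* a) T) (cong (_* + T) (ℤₚ.pos-* 2 a))) refl 1≤R
    term₂ : sdiv (+ (T ℕ.* T) + + 2 * σ) (R ℕ.* R) ≋ + T * + T + + 2 * (+ R * U - + S * + T) / + R * + R
    term₂ = sdiv-≋ _ (R ℕ.* R) (cong₂ (λ t² s → t² + + 2 * s) (ℤₚ.pos-* T T) σ≡det) (ℤₚ.pos-* R R)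
                        (ℕₚ.*-mono-≤ 1≤R 1≤R)
    term₃ : sdiv (+ 2 * σ * (+ T - + (2 ℕ.* S))) Dₙ ≋ + 2 * (+ R * U - + S * + T) * (+ T - + 2 * + S) / D
    term₃ = sdiv-≋ _ Dₙ (cong₂ (λ s 2S → + 2 * s * (+ T - 2S)) σ≡det (ℤₚ.pos-* 2 S)) +Dₙ≡D 1≤Dₙ
    instance
      R≢0 : ℕ.NonZero R
      R≢0 = ℕ.>-nonZero 1≤R
      D≢0 : NonZero D
      D≢0 = subst NonZero +Dₙ≡D (ℕ.>-nonZero 1≤Dₙ)
    denominator≢0 : NonZero (+ 1 * + R * (+ R * + R) * D)
    denominator≢0 = ℤₚ.i*j≢0 (+ 1 * + R * (+ R * + R)) D
      {{ℤₚ.i*j≢0 (+ 1 * + R) (+ R * + R) {{ℤₚ.i*j≢0 (+ 1) (+ R)}} {{ℤₚ.i*j≢0 (+ R) (+ R)}}}}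
    denominators-cleared : ∀ a R S T U →
      let P = a * R + T ; P′ = a * S + U ; σ = R * U - S * T
          D = R * R * (a * R + + 2 * S) ; K = R * P * (a * P + + 2 * P′)
      in (((a * a * R + + 2 * a * T * + 1) * (R * R) + (T * T + + 2 * σ) * (+ 1 * R)) * D
           + + 2 * σ * (T - + 2 * S) * (+ 1 * R * (R * R))) * D
         ≡ K * (+ 1 * R * (R * R) * D)
    denominators-cleared = solve-∀

  square-sub-rhs-≋ : ∀ n →
    convergent a as n ℚ.* convergent a as n ℚ.- rhs a as
      ≋ formValue n / + (denominator n ℕ.* denominator n ℕ.* Dₙ)
  square-sub-rhs-≋ n = subst₂ (c ℚ.* c ℚ.- rhs a as ≋_/_)
                              (regroup D K (+ numerator n) (+ denominator n)) denominator≡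
                              (≋-- (≋-* (convergent-≋ n) (convergent-≋ n)) rhs-≋)
    where
    c = convergent a as n
    regroup : ∀ D K p Q → p * p * D + - K * (Q * Q) ≡ D * p * p - K * Q * Q
    regroup = solve-∀
    denominator≡ : + denominator n * + denominator n * D ≡ + (denominator n ℕ.* denominator n ℕ.* Dₙ)
    denominator≡ = sym (trans (ℤₚ.pos-* (denominator n ℕ.* denominator n) Dₙ)
                              (cong₂ _*_ (ℤₚ.pos-* (denominator n) (denominator n)) +Dₙ≡D))

  C : ℕ
  C = proj₁ formValue-bounded

  formValue-small : ∀ k f n → suc (2 ℕ.* (C ℕ.* suc f)) ≤ n →
    ∣ formValue n ∣ ℕ.* suc f < suc k ℕ.* (denominator n ℕ.* denominator n ℕ.* Dₙ)
  formValue-small k f n N≤n = begin-strict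
    ∣ formValue n ∣ ℕ.* suc f          ≤⟨ ℕₚ.*-monoˡ-≤ (suc f) (proj₂ formValue-bounded n) ⟩
    C ℕ.* suc f                        <⟨ ℕₚ.*-cancelˡ-< 2 _ _ (ℕₚ.≤-trans N≤n (n≤2*denominator n)) ⟩
    Q                                  ≤⟨ ℕₚ.m≤m*n Q Q ⟩
    Q ℕ.* Q                            ≤⟨ ℕₚ.m≤m*n (Q ℕ.* Q) Dₙ ⟩
    Q ℕ.* Q ℕ.* Dₙ                     ≤⟨ ℕₚ.m≤n*m _ (suc k) ⟩
    suc k ℕ.* (Q ℕ.* Q ℕ.* Dₙ)         ∎
    where
    open ℕₚ.≤-Reasoning
    Q = denominator n
    instance
      Q≢0 : ℕ.NonZero Q
      Q≢0 = ℕ.>-nonZero (1≤denominator n)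
      Dₙ≢0 : ℕ.NonZero Dₙ
      Dₙ≢0 = ℕ.>-nonZero 1≤Dₙ

lemma4p1 : (a : ℕ) (as : List ℕ) → 3 ≤ a → All (1 ≤_) as →
    SquareOfCFIs (convergent a as) (rhs a as)
lemma4p1 a as 3≤a as⁺ (mkℚ +[1+ k ] f _) _ =
  suc (2 ℕ.* (C ℕ.* suc f)) , λ n N≤n → ∣≋∣< k f (square-sub-rhs-≋ n) (formValue-small k f n N≤n)
  where open PeriodicExpansion a as (ℕₚ.≤-trans (s≤s z≤n) 3≤a) as⁺  -- only 1 ≤ a is needed
lemma4p1 _ _ _ _ (mkℚ (+ 0) _ _) (ℚ.*<* (ℤ.+<+ ()))
lemma4p1 _ _ _ _ (mkℚ -[1+ _ ] _ _) (ℚ.*<* ())
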